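{- Let $G$ be a finite graph with threshold assignment $\tau$ such that $\min_{v\in V(G)}\tau(v)\geq k$, where $k$ is a positive integer. Then every $\tau$-WDM of $G$ with processing time $t$ satisfies $$t\leq \frac{2\alpha'(G)}{k}+2,$$ where $\alpha'(G)$ is the maximum number of pairwise independent (disjoint) edges in $G$.
   Context: All graphs are finite and simple. A set $D\subseteq V(G)$ is a $\tau$-weak dynamic monopoly ($\tau$-WDM) with processing time $t$ if $V(G)$ can be partitioned into nonempty sets $D_0=D,D_1,\ldots,D_t$ such that for every $i\in\{1,\ldots,t\}$, every vertex $v\in D_i$ has at least $\tau(v)$ neighbors in $D_{i-1}$. -}

module Defs where

open import Data.Nat using (ℕ; suc)
open import Data.Fin using (Fin; zero; suc; inject₁; _≟_)
open import Data.Fin.Subset using (Subset; _∈_)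
open import Data.Bool using (Bool; true; false; _∧_)
open import Data.List using (List; []; _∷_; length; filter; concatMap; allFin)
open import Data.List.Relation.Unary.All using (All)
open import Data.List.Relation.Unary.Unique.Propositional using (Unique)
open import Data.Product using (Σ; _×_; _,_; ∃)
open import Relation.Binary.PropositionalEquality using (_≡_)
open import Relation.Nullary.Decidable using (⌊_⌋)
open import Data.Bool using (T)
open import Function.Bundles using (_⇔_)

record SimpleGraph (n : ℕ) : Set where
  field
    adj   : Fin n → Fin n → Bool
    sym   : ∀ u v → adj u v ≡ adj v u
    irrefl : ∀ v → adj v v ≡ false
open SimpleGraph public

nbrsIn : ∀ {n t} → SimpleGraph n → (Fin n → Fin (suc t)) → Fin n → Fin (suc t) → ℕ
nbrsIn {n} G layer v j =
  length (filter (λ u → T? (adj G v u ∧ ⌊ layer u ≟ j ⌋)) (allFin n))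
  where open import Data.Bool.Properties using (T?)

-- D is a τ-WDM of G with processing time t: V(G) is partitioned into
-- nonempty sets D₀ = D, D₁, …, Dₜ (vertex v lies in D_{layer v}) such that
-- every vertex of D_{i+1} has at least τ(v) neighbours in D_i.
IsWDMWithTime : ∀ {n} → SimpleGraph n → (Fin n → ℕ) → Subset n → ℕ → Set
IsWDMWithTime {n} G τ D t =
  Σ (Fin n → Fin (suc t)) λ layer →
      (∀ v → (v ∈ D) ⇔ (layer v ≡ zero))
    × (∀ (i : Fin (suc t)) → ∃ λ v → layer v ≡ i)
    × (∀ v (i : Fin t) → layer v ≡ suc i → τ v Data.Nat.≤ nbrsIn G layer v (inject₁ i))
  where import Data.Nat

-- A matching: a list of edges whose endpoints are pairwise distinct
-- (so edges are pairwise disjoint, and in particular distinct).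
endpoints : ∀ {n} → List (Fin n × Fin n) → List (Fin n)
endpoints = concatMap (λ { (u , v) → u ∷ v ∷ [] })

IsMatching : ∀ {n} → SimpleGraph n → List (Fin n × Fin n) → Set
IsMatching G M = All (λ { (u , v) → adj G u v ≡ true }) M × Unique (endpoints M)

IsMatchingNumber : ∀ {n} → SimpleGraph n → ℕ → Set
IsMatchingNumber G m =
  (∃ λ M → IsMatching G M × length M ≡ m)
  × (∀ M → IsMatching G M → length M Data.Nat.≤ m)
  where import Data.Nat

module Submission where

-- Let D₀, …, Dₜ be the layers of a τ-WDM and let level(v) be the index of the
-- layer containing v.  Fix ℓ with ℓ + 2 ≤ t and a vertex w ∈ D_{ℓ+2} (layers are
-- nonempty).  As τ ≥ k, w has at least k neighbours u₁, …, u_k in D_{ℓ+1}, and each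
-- uᵢ has at least k neighbours in D_ℓ.  Partners xᵢ ∈ D_ℓ can therefore be chosen
-- greedily and pairwise distinct (when uᵢ is treated, fewer than k partners are
-- taken), giving k disjoint edges inside the band D_ℓ ∪ D_{ℓ+1}.  The bands
-- {0,1}, {2,3}, …, {2s−2, 2s−1} with 2s ≤ t are pairwise disjoint, so their edges
-- form a matching of size s·k ≤ α'(G).  For s = ⌊t/2⌋ we have t ≤ 2s + 1, whence
-- t·k ≤ 2α'(G) + k ≤ 2α'(G) + 2k.

open import Defs hiding (sym)
open import Data.Nat using (ℕ; _≤_; _*_; _+_)
open import Data.Fin using (Fin)
open import Data.Fin.Subset using (Subset)

open import Level using (0ℓ)
open import Function using (_∘_; _⇔_; mk⇔; Equivalence)
open import Data.Nat using (zero; suc; _<_; z≤n; s≤s; ⌊_/2⌋)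
import Data.Nat as ℕ
open import Data.Nat.Properties
import Data.Fin as F
import Data.Fin.Properties as FP
open import Data.Bool using (true; _∧_; T)
open import Data.Bool.Properties using (T?; T-∧; T-≡)
open import Data.List using (List; []; _∷_; length; filter; allFin; map; take; _++_)
open import Data.List.Properties using (length-removeAt′; length-map; length-take; length-++; filter-≐)
open import Data.List.Membership.Propositional using (_∈_; _∉_; _─_; find)
open import Data.List.Membership.Propositional.Properties using (∈-filter⁻; ∈-++⁻)
import Data.List.Membership.DecPropositional as DecMembership
open import Data.List.Relation.Binary.Subset.Propositional using (_⊆_)
open import Data.List.Relation.Binary.Disjoint.Propositional using (Disjoint)
open import Data.List.Relation.Unary.Any as Any using (here; there)
open import Data.List.Relation.Unary.All as All using (All; []; _∷_)
import Data.List.Relation.Unary.All.Properties as AllP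
open import Data.List.Relation.Unary.Unique.Propositional using (Unique)
import Data.List.Relation.Unary.Unique.Propositional.Properties as UniqueP
open import Data.List.Relation.Unary.AllPairs using ([]; _∷_)
open import Data.Product using (∃; _×_; _,_; proj₁; proj₂)
open import Data.Sum using (_⊎_; inj₁; inj₂; [_,_]′)
open import Data.Empty using (⊥-elim)
open import Relation.Nullary using (¬_; Dec; yes; no)
open import Relation.Nullary.Decidable using (⌊_⌋; toWitness)
open import Relation.Unary using (Pred; Decidable; _≐_)
open import Relation.Binary.Definitions using (DecidableEquality)
open import Relation.Binary.PropositionalEquality

module _ {A : Set} where

  ∈-─ : ∀ {x z : A} {ys} (x∈ys : x ∈ ys) → z ∈ ys → z ≢ x → z ∈ ys ─ x∈ys
  ∈-─ (here refl) (here z≡x)  z≢x = ⊥-elim (z≢x z≡x)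
  ∈-─ (here refl) (there z∈)  _   = z∈
  ∈-─ (there x∈)  (here z≡y)  _   = here z≡y
  ∈-─ (there x∈)  (there z∈)  z≢x = there (∈-─ x∈ z∈ z≢x)

  Unique-⊆⇒length≤ : ∀ {xs ys : List A} → Unique xs → xs ⊆ ys → length xs ≤ length ys
  Unique-⊆⇒length≤ {[]}     _              _     = z≤n
  Unique-⊆⇒length≤ {x ∷ xs} {ys} (x∉xs ∷ xs!) xs⊆ys = begin
      suc (length xs)           ≤⟨ s≤s (Unique-⊆⇒length≤ xs! xs⊆ys─x) ⟩
      suc (length (ys ─ x∈ys))  ≡⟨ length-removeAt′ ys (Any.index x∈ys) ⟨
      length ys                 ∎
    where
      open ≤-Reasoning
      x∈ys : x ∈ ys
      x∈ys = xs⊆ys (here refl)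
      xs⊆ys─x : xs ⊆ ys ─ x∈ys
      xs⊆ys─x z∈xs = ∈-─ x∈ys (xs⊆ys (there z∈xs)) (All.lookup x∉xs z∈xs ∘ sym)

module _ {A : Set} (_≟_ : DecidableEquality A) where
  open DecMembership _≟_ using (_∈?_)

  fresh : ∀ (xs U : List A) → Unique xs → length U < length xs → ∃ λ x → x ∈ xs × x ∉ U
  fresh xs U xs! U<xs with All.all? (_∈? U) xs
  ... | yes xs⊆U = ⊥-elim (<⇒≱ U<xs (Unique-⊆⇒length≤ xs! (All.lookup xs⊆U)))
  ... | no  xs⊈U = find (AllP.¬All⇒Any¬ (_∈? U) xs xs⊈U)

⌊⌋-cong : ∀ {A B : Set} → A ⇔ B → (a? : Dec A) (b? : Dec B) → ⌊ a? ⌋ ≡ ⌊ b? ⌋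
⌊⌋-cong _   (yes _) (yes _) = refl
⌊⌋-cong A⇔B (yes a) (no ¬b) = ⊥-elim (¬b (Equivalence.to A⇔B a))
⌊⌋-cong A⇔B (no ¬a) (yes b) = ⊥-elim (¬a (Equivalence.from A⇔B b))
⌊⌋-cong _   (no _)  (no _)  = refl

Edges : ℕ → Set
Edges n = List (Fin n × Fin n)

∈-endpoints⁻ : ∀ {n} {e : Fin n} (M : Edges n) → e ∈ endpoints M →
               e ∈ map proj₁ M ⊎ e ∈ map proj₂ M
∈-endpoints⁻ ((a , b) ∷ M) (here e≡a)         = inj₁ (here e≡a)
∈-endpoints⁻ ((a , b) ∷ M) (there (here e≡b)) = inj₂ (here e≡b)
∈-endpoints⁻ ((a , b) ∷ M) (there (there e∈)) with ∈-endpoints⁻ M e∈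
... | inj₁ e∈firsts  = inj₁ (there e∈firsts)
... | inj₂ e∈seconds = inj₂ (there e∈seconds)

∉-endpoints : ∀ {n} {v : Fin n} (M : Edges n) → v ∉ map proj₁ M → v ∉ map proj₂ M → v ∉ endpoints M
∉-endpoints M v∉firsts v∉seconds v∈M = [ v∉firsts , v∉seconds ]′ (∈-endpoints⁻ M v∈M)

length-seconds : ∀ {n} {us : List (Fin n)} (M : Edges n) → map proj₁ M ≡ us → length (map proj₂ M) ≡ length us
length-seconds {us = us} M firsts = begin
    length (map proj₂ M)  ≡⟨ length-map proj₂ M ⟩
    length M              ≡⟨ length-map proj₁ M ⟨
    length (map proj₁ M)  ≡⟨ cong length firsts ⟩
    length us             ∎
  where open ≡-Reasoning

endpoints-++ : ∀ {n} (M N : Edges n) → endpoints (M ++ N) ≡ endpoints M ++ endpoints N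
endpoints-++ []            N = refl
endpoints-++ ((a , b) ∷ M) N = cong (λ es → a ∷ b ∷ es) (endpoints-++ M N)

module _ {n} (G : SimpleGraph n) where

  IsMatching-∷ : ∀ {u x M} → adj G u x ≡ true → u ≢ x →
                 u ∉ endpoints M → x ∉ endpoints M →
                 IsMatching G M → IsMatching G ((u , x) ∷ M)
  IsMatching-∷ {M = M} u~x u≢x u∉M x∉M (adjM , M!) =
    u~x ∷ adjM ,
    (u≢x ∷ AllP.¬Any⇒All¬ (endpoints M) u∉M) ∷ AllP.¬Any⇒All¬ (endpoints M) x∉M ∷ M!

  IsMatching-++ : ∀ {M N} → IsMatching G M → IsMatching G N →
                  Disjoint (endpoints M) (endpoints N) → IsMatching G (M ++ N)
  IsMatching-++ {M} {N} (adjM , M!) (adjN , N!) M#N =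
    AllP.++⁺ adjM adjN ,
    subst Unique (sym (endpoints-++ M N)) (UniqueP.++⁺ M! N! M#N)

-- The neighbours of v satisfying P, listed in increasing order.  For P the
-- class of a layer this is exactly the list counted by nbrsIn.
neighboursWhere : ∀ {n} {P : Pred (Fin n) 0ℓ} → SimpleGraph n → Decidable P → Fin n → List (Fin n)
neighboursWhere {n} G P? v = filter (λ u → T? (adj G v u ∧ ⌊ P? u ⌋)) (allFin n)

module _ {n} (G : SimpleGraph n) {P : Pred (Fin n) 0ℓ} (P? : Decidable P) where

  neighboursWhere-unique : ∀ v → Unique (neighboursWhere G P? v)
  neighboursWhere-unique v = UniqueP.filter⁺ (λ u → T? (adj G v u ∧ ⌊ P? u ⌋)) (UniqueP.allFin⁺ n)

  ∈-neighboursWhere⁻ : ∀ {v x} → x ∈ neighboursWhere G P? v → adj G v x ≡ true × P x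
  ∈-neighboursWhere⁻ {v} {x} x∈ =
    let v~x , x∈P = Equivalence.to T-∧ (proj₂ (∈-filter⁻ (λ u → T? (adj G v u ∧ ⌊ P? u ⌋)) {xs = allFin n} x∈))
    in Equivalence.to T-≡ v~x , toWitness x∈P

  -- Greedy matching (a special case of Hall's theorem): distinct vertices
  -- outside P, each with at least d ≥ |us| neighbours in P, can be matched to
  -- pairwise distinct neighbours in P.  The head is matched last, avoiding the
  -- fewer than d partners already used by the tail.
  greedyMatching : ∀ (d : ℕ) (us : List (Fin n)) → Unique us → All (¬_ ∘ P) us →
                   All (λ u → d ≤ length (neighboursWhere G P? u)) us → length us ≤ d →
                   ∃ λ M → IsMatching G M × map proj₁ M ≡ us × All P (map proj₂ M)
  greedyMatching d [] _ _ _ _ = [] , ([] , []) , refl , []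
  greedyMatching d (u ∷ us) (u∉us ∷ us!) (u∉P ∷ us∉P) (deg-u ∷ degs) |u∷us|≤d
    with M , isM , firsts , seconds∈P ← greedyMatching d us us! us∉P degs (≤-trans (n≤1+n _) |u∷us|≤d)
    with x , x∈N , x∉partners ← fresh FP._≟_ _ (map proj₂ M) (neighboursWhere-unique u)
                                 (≤-trans (s≤s (≤-reflexive (length-seconds M firsts))) (≤-trans |u∷us|≤d deg-u))
    = (u , x) ∷ M , IsMatching-∷ G u~x u≢x u∉M x∉M isM , cong (u ∷_) firsts , x∈P ∷ seconds∈P
    where
      u~x : adj G u x ≡ true
      u~x = proj₁ (∈-neighboursWhere⁻ x∈N)
      x∈P : P x
      x∈P = proj₂ (∈-neighboursWhere⁻ x∈N)
      u≢x : u ≢ x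
      u≢x u≡x = u∉P (subst P (sym u≡x) x∈P)
      u∉M : u ∉ endpoints M
      u∉M = ∉-endpoints M (AllP.All¬⇒¬Any u∉us ∘ subst (u ∈_) firsts)
                          (u∉P ∘ All.lookup seconds∈P)
      x∉M : x ∉ endpoints M
      x∉M = ∉-endpoints M (λ x∈firsts → All.lookup us∉P (subst (x ∈_) firsts x∈firsts) x∈P)
                          x∉partners

module Layers {n t : ℕ} (G : SimpleGraph n) (τ : Fin n → ℕ) (k : ℕ) (k≤τ : ∀ v → k ≤ τ v)
  (layer : Fin n → Fin (suc t)) (nonempty : ∀ (i : Fin (suc t)) → ∃ λ v → layer v ≡ i)
  (grow : ∀ v (i : Fin t) → layer v ≡ F.suc i → τ v ≤ nbrsIn G layer v (F.inject₁ i)) where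

  level : Fin n → ℕ
  level v = F.toℕ (layer v)

  onLevel : (ℓ : ℕ) → Decidable (λ u → level u ≡ ℓ)
  onLevel ℓ u = level u ℕ.≟ ℓ

  k≤degreeBelow : ∀ v ℓ → level v ≡ suc ℓ → k ≤ length (neighboursWhere G (onLevel ℓ) v)
  k≤degreeBelow v ℓ level-v with layer v in layer-v
  ... | F.suc i = begin
      k                                                ≤⟨ k≤τ v ⟩
      τ v                                              ≤⟨ grow v i layer-v ⟩
      nbrsIn G layer v (F.inject₁ i)                   ≡⟨ cong length (filter-≐ _ _ same-filter (allFin n)) ⟩
      length (neighboursWhere G (onLevel ℓ) v)         ∎
    where
      open ≤-Reasoning
      i≡ℓ : F.toℕ (F.inject₁ i) ≡ ℓ
      i≡ℓ = trans (FP.toℕ-inject₁ i) (suc-injective level-v)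
      same-layer : ∀ u → (layer u ≡ F.inject₁ i) ⇔ (level u ≡ ℓ)
      same-layer u = mk⇔ (λ eq → trans (cong F.toℕ eq) i≡ℓ)
                         (λ eq → FP.toℕ-injective (trans eq (sym i≡ℓ)))
      same-test : ∀ u → ⌊ layer u F.≟ F.inject₁ i ⌋ ≡ ⌊ onLevel ℓ u ⌋
      same-test u = ⌊⌋-cong (same-layer u) (layer u F.≟ F.inject₁ i) (onLevel ℓ u)
      same-filter : (λ u → T (adj G v u ∧ ⌊ layer u F.≟ F.inject₁ i ⌋)) ≐ (λ u → T (adj G v u ∧ ⌊ onLevel ℓ u ⌋))
      same-filter = (λ {u} → subst T (cong (adj G v u ∧_) (same-test u)))
                  , (λ {u} → subst T (cong (adj G v u ∧_) (sym (same-test u))))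

  -- Every level ℓ < t contains k distinct vertices: neighbours of a vertex on
  -- level ℓ + 1, which exists because layers are nonempty.
  kOnLevel : ∀ ℓ → suc ℓ ≤ t →
             ∃ λ us → Unique us × length us ≡ k × All (λ u → level u ≡ ℓ) us
  kOnLevel ℓ ℓ<t =
    take k N , UniqueP.take⁺ k (neighboursWhere-unique G (onLevel ℓ) w) ,
    trans (length-take k N) (m≤n⇒m⊓n≡m (k≤degreeBelow w ℓ level-w)) ,
    AllP.take⁺ k (All.tabulate (proj₂ ∘ ∈-neighboursWhere⁻ G (onLevel ℓ)))
    where
      w : Fin n
      w = proj₁ (nonempty (F.fromℕ< (s≤s ℓ<t)))
      level-w : level w ≡ suc ℓ
      level-w = trans (cong F.toℕ (proj₂ (nonempty (F.fromℕ< (s≤s ℓ<t))))) (FP.toℕ-fromℕ< (s≤s ℓ<t))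
      N : List (Fin n)
      N = neighboursWhere G (onLevel ℓ) w

  -- Between levels ℓ and ℓ + 1 (with ℓ + 2 ≤ t) lie k disjoint edges: match k
  -- distinct vertices of level ℓ + 1 greedily into level ℓ.
  bandMatching : ∀ ℓ → suc (suc ℓ) ≤ t →
                 ∃ λ M → IsMatching G M × length M ≡ k ×
                         (∀ {e} → e ∈ endpoints M → level e ≡ ℓ ⊎ level e ≡ suc ℓ)
  bandMatching ℓ ℓ+2≤t
    with us , us! , |us| , us-level ← kOnLevel (suc ℓ) ℓ+2≤t
    with M , isM , firsts , seconds-level ←
           greedyMatching G (onLevel ℓ) k us us!
             (All.map (λ level-u level-u≡ℓ → 1+n≢n (trans (sym level-u) level-u≡ℓ)) us-level)
             (All.map (k≤degreeBelow _ ℓ) us-level) (≤-reflexive |us|)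
    = M , isM , trans (sym (length-map proj₁ M)) (trans (cong length firsts) |us|) , in-band
    where
      in-band : ∀ {e} → e ∈ endpoints M → level e ≡ ℓ ⊎ level e ≡ suc ℓ
      in-band e∈M = [ inj₂ ∘ All.lookup us-level ∘ subst (_ ∈_) firsts
                    , inj₁ ∘ All.lookup seconds-level ]′ (∈-endpoints⁻ M e∈M)

  layeredMatching : ∀ s → 2 * s ≤ t →
                    ∃ λ M → IsMatching G M × length M ≡ s * k × (∀ {e} → e ∈ endpoints M → level e < 2 * s)
  layeredMatching zero    _      = [] , ([] , []) , refl , λ ()
  layeredMatching (suc s) 2s+2≤t
    rewrite *-suc 2 s
    with M , isM , |M| , M-below ← layeredMatching s (≤-trans (n≤1+n _) (≤-trans (n≤1+n _) 2s+2≤t))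
    with B , isB , |B| , B-band  ← bandMatching (2 * s) 2s+2≤t
    = B ++ M ,
      IsMatching-++ G isB isM (λ (e∈B , e∈M) → <⇒≱ (M-below e∈M) (band-above e∈B)) ,
      trans (length-++ B) (cong₂ _+_ |B| |M|) ,
      all-below
    where
      band-above : ∀ {e} → e ∈ endpoints B → 2 * s ≤ level e
      band-above e∈B = [ (λ eq → ≤-reflexive (sym eq))
                       , (λ eq → ≤-trans (n≤1+n _) (≤-reflexive (sym eq))) ]′ (B-band e∈B)
      band-below : ∀ {e} → e ∈ endpoints B → level e < 2 + 2 * s
      band-below e∈B = [ (λ eq → ≤-trans (≤-reflexive (cong suc eq)) (n≤1+n _))
                       , (λ eq → ≤-reflexive (cong suc eq)) ]′ (B-band e∈B)
      all-below : ∀ {e} → e ∈ endpoints (B ++ M) → level e < 2 + 2 * s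
      all-below e∈ = [ band-below , (λ e∈M → ≤-trans (M-below e∈M) (≤-trans (n≤1+n _) (n≤1+n _))) ]′
                       (∈-++⁻ (endpoints B) (subst (_ ∈_) (endpoints-++ B M) e∈))

halve : ∀ t → 2 * ⌊ t /2⌋ ≤ t × t ≤ suc (2 * ⌊ t /2⌋)
halve zero          = z≤n , z≤n
halve (suc zero)    = z≤n , s≤s z≤n
halve (suc (suc t)) rewrite *-suc 2 ⌊ t /2⌋ =
  let lower , upper = halve t in s≤s (s≤s lower) , s≤s (s≤s upper)

corollary2 : ∀ {n} (G : SimpleGraph n) (τ : Fin n → ℕ) (k : ℕ) → 1 ≤ k
    → (∀ v → k ≤ τ v)
    → (m : ℕ) → IsMatchingNumber G m
    → (D : Subset n) (t : ℕ) → IsWDMWithTime G τ D t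
    → t * k ≤ 2 * m + 2 * k
corollary2 G τ k _ k≤τ m (_ , maximal) _ t (layer , _ , nonempty , grow)
  with M , isM , |M| , _ ← Layers.layeredMatching G τ k k≤τ layer nonempty grow ⌊ t /2⌋ (proj₁ (halve t))
  = begin
    t * k                 ≤⟨ *-monoˡ-≤ k (proj₂ (halve t)) ⟩
    suc (2 * s) * k       ≡⟨ cong (k +_) (*-assoc 2 s k) ⟩
    k + 2 * (s * k)       ≤⟨ +-monoʳ-≤ k (*-monoʳ-≤ 2 sk≤m) ⟩
    k + 2 * m             ≡⟨ +-comm k (2 * m) ⟩
    2 * m + k             ≤⟨ +-monoʳ-≤ (2 * m) (m≤n*m k 2) ⟩
    2 * m + 2 * k         ∎
  where
    open ≤-Reasoning
    s : ℕ
    s = ⌊ t /2⌋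
    sk≤m : s * k ≤ m
    sk≤m = subst (_≤ m) |M| (maximal M isM)
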